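{- Let $p=(231,\emptyset,\emptyset)$ and $r=(123,\emptyset,\{1\})$. Then for every $n\ge 0$, \[\mathrm{Av}_n(p,r)=\mathrm{Av}_n(123,231).\]
   Context: For $n\ge 0$, $\mathcal{S}_n$ is the set of permutations of $[n]=\{1,\dots,n\}$, written as words $\pi=\pi(1)\pi(2)\cdots\pi(n)$. Two words of distinct integers of the same length are order-isomorphic if their entries appear in the same relative order. A pattern of length 3 is a triple $(\sigma,X,Y)$ with $\sigma\in\mathcal{S}_3$ and $X,Y\subseteq\{1,2\}$. A permutation $\pi\in\mathcal{S}_n$ contains $(\sigma,X,Y)$ if there are indices $i_1<i_2<i_3$ such that $\pi(i_1)\pi(i_2)\pi(i_3)$ is order-isomorphic to $\sigma$, $i_{x+1}=i_x+1$ for every $x\in X$, and $j_{y+1}=j_y+1$ for every $y\in Y$, where $j_1<j_2<j_3$ are the three values $\pi(i_1),\pi(i_2),\pi(i_3)$ listed in increasing order; otherwise $\pi$ avoids it. A classical pattern $\sigma$ means $(\sigma,\emptyset,\emptyset)$. For patterns $P_1,\dots,P_m$, $\mathrm{Av}_n(P_1,\dots,P_m)$ is the set of $\pi\in\mathcal{S}_n$ avoiding every $P_i$. -}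

module Defs where

open import Data.Nat using (ℕ; suc)
open import Data.Fin using (Fin; toℕ; zero; suc; _<_; inject₁)
open import Data.Fin.Permutation using (Permutation′; _⟨$⟩ʳ_; _⟨$⟩ˡ_; permutation; id)
open import Data.Fin.Subset using (Subset; _∈_; ⊥; ⁅_⁆)
open import Data.Product using (Σ; _×_)
open import Relation.Binary.PropositionalEquality using (_≡_; refl)
open import Relation.Nullary using (¬_)
open import Function.Bundles using (_⇔_)

-- A permutation of [n], with [n] represented by Fin n (0-based).
Perm : ℕ → Set
Perm n = Permutation′ n

-- A pattern of length 3: (σ , X , Y) with σ ∈ S₃ and X, Y ⊆ {1,2}.
-- {1,2} is represented by Fin 2 (x = 1 ↦ zero, x = 2 ↦ suc zero).
record Pattern3 : Set where
  constructor pat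
  field
    σ : Perm 3
    X : Subset 2
    Y : Subset 2

open Pattern3 public

-- Since the occurrence is
-- order-isomorphic to σ, the k-th smallest value is π(i_{σ⁻¹(k)}).
Contains : {n : ℕ} → Perm n → Pattern3 → Set
Contains {n} π (pat σ X Y) =
  Σ (Fin 3 → Fin n) λ i →
    ((a b : Fin 3) → toℕ a Data.Nat.< toℕ b → i a < i b)
    × ((a b : Fin 3) → (π ⟨$⟩ʳ i a < π ⟨$⟩ʳ i b) ⇔ (σ ⟨$⟩ʳ a < σ ⟨$⟩ʳ b))
    × ((x : Fin 2) → x ∈ X → toℕ (i (suc x)) ≡ suc (toℕ (i (inject₁ x))))
    × ((y : Fin 2) → y ∈ Y →
         toℕ (π ⟨$⟩ʳ i (σ ⟨$⟩ˡ suc y)) ≡ suc (toℕ (π ⟨$⟩ʳ i (σ ⟨$⟩ˡ inject₁ y))))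

Avoids : {n : ℕ} → Perm n → Pattern3 → Set
Avoids π P = ¬ Contains π P

σ123 : Perm 3
σ123 = id

private
  f231 g231 : Fin 3 → Fin 3
  f231 zero = suc zero
  f231 (suc zero) = suc (suc zero)
  f231 (suc (suc zero)) = zero
  g231 zero = suc (suc zero)
  g231 (suc zero) = zero
  g231 (suc (suc zero)) = suc zero
  fg : ∀ x → f231 (g231 x) ≡ x
  fg zero = refl
  fg (suc zero) = refl
  fg (suc (suc zero)) = refl
  gf : ∀ x → g231 (f231 x) ≡ x
  gf zero = refl
  gf (suc zero) = refl
  gf (suc (suc zero)) = refl

σ231 : Perm 3
σ231 = permutation f231 g231 fg gf

classical : Perm 3 → Pattern3
classical s = pat s ⊥ ⊥

Y1 : Subset 2
Y1 = ⁅ zero ⁆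

InAv2 : {n : ℕ} → Pattern3 → Pattern3 → Perm n → Set
InAv2 P Q π = Avoids π P × Avoids π Q

-- A 123 occurrence a < b < c of minimal value gap π(b) − π(a) cannot exist in a
-- 231-avoider that avoids r.  If π(b) = π(a) + 1 it is an occurrence of r.
-- Otherwise let d be the position of the value π(a) + 1: if d < b then d b c is a
-- 123 occurrence with smaller gap, if b < d < c then a d c is an occurrence of r,
-- and if c < d then b c d is an occurrence of 231.
module Submission where

open import Defs
open import Data.Nat using (ℕ)
open import Data.Fin.Subset using (⊥)
open import Function.Bundles using (_⇔_)

open import Data.Nat as ℕ using (zero; suc; _+_; _∸_; z≤n; s≤s)
open import Data.Nat.Properties as ℕ using (m≤m+n; m+[n∸m]≡n; +-identityʳ; +-suc)
open import Data.Fin using (Fin; toℕ; fromℕ<; inject₁; _<_)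
open import Data.Fin.Properties as Fin using (toℕ<n; toℕ-fromℕ<)
open import Data.Fin.Subset using (_⊆_; _∈_)
open import Data.Fin.Subset.Properties using (⊥⊆; ∉⊥; x∈⁅y⁆⇒x≡y)
open import Data.Fin.Permutation using (_⟨$⟩ʳ_; _⟨$⟩ˡ_; inverseʳ)
open import Data.Vec.Functional using ([]; _∷_)
open import Data.Product using (Σ; _,_)
open import Data.Empty using (⊥-elim) renaming (⊥ to Empty)
open import Function.Bundles using (mk⇔; Equivalence)
open import Relation.Binary.Core using (Rel)
open import Relation.Binary.Definitions using (Transitive; tri<; tri≈; tri>)
open import Relation.Binary.PropositionalEquality
  using (_≡_; refl; sym; trans; cong; subst)

triple-increasing : ∀ {a ℓ} {A : Set a} {_≺_ : Rel A ℓ} → Transitive _≺_ →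
  {x y z : A} → x ≺ y → y ≺ z →
  ∀ i j → i < j → (x ∷ y ∷ z ∷ []) i ≺ (x ∷ y ∷ z ∷ []) j
triple-increasing trans x≺y y≺z Fin.zero (Fin.suc Fin.zero) _ = x≺y
triple-increasing trans x≺y y≺z Fin.zero (Fin.suc (Fin.suc Fin.zero)) _ = trans x≺y y≺z
triple-increasing trans x≺y y≺z (Fin.suc Fin.zero) (Fin.suc (Fin.suc Fin.zero)) _ = y≺z
triple-increasing trans x≺y y≺z Fin.zero Fin.zero ()
triple-increasing trans x≺y y≺z (Fin.suc Fin.zero) Fin.zero ()
triple-increasing trans x≺y y≺z (Fin.suc Fin.zero) (Fin.suc Fin.zero) (s≤s ())
triple-increasing trans x≺y y≺z (Fin.suc (Fin.suc Fin.zero)) Fin.zero ()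
triple-increasing trans x≺y y≺z (Fin.suc (Fin.suc Fin.zero)) (Fin.suc Fin.zero) (s≤s ())
triple-increasing trans x≺y y≺z (Fin.suc (Fin.suc Fin.zero)) (Fin.suc (Fin.suc Fin.zero)) (s≤s (s≤s ()))

increasing⇒<-reflecting : ∀ {m} (h : Fin m → ℕ) → (∀ i j → i < j → h i ℕ.< h j) →
  ∀ i j → h i ℕ.< h j ⇔ i < j
increasing⇒<-reflecting h increasing i j = mk⇔ reflect (increasing i j)
  where
  reflect : h i ℕ.< h j → i < j
  reflect hi<hj with Fin.<-cmp i j
  ... | tri< i<j _ _ = i<j
  ... | tri≈ _ refl _ = ⊥-elim (ℕ.<-irrefl refl hi<hj)
  ... | tri> _ _ j<i = ⊥-elim (ℕ.<-asym hi<hj (increasing j i j<i))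

Contains-⊆ʸ : ∀ {n} {π : Perm n} {σ X Y Y′} → Y′ ⊆ Y →
  Contains π (pat σ X Y) → Contains π (pat σ X Y′)
Contains-⊆ʸ Y′⊆Y (i , increasing , iso , adjacentˣ , adjacentʸ) =
  i , increasing , iso , adjacentˣ , λ y y∈Y′ → adjacentʸ y (Y′⊆Y y∈Y′)

gap⇒< : ∀ {m n k} → suc m + k ≡ n → m ℕ.< n
gap⇒< {m} {k = k} gap = ℕ.≤-trans (m≤m+n (suc m) k) (ℕ.≤-reflexive gap)

module _ {n : ℕ} (π : Perm n) where

  value : Fin n → ℕ
  value i = toℕ (π ⟨$⟩ʳ i)

  position-of : ∀ v → v ℕ.< n → Σ (Fin n) λ d → value d ≡ v
  position-of v v<n = π ⟨$⟩ˡ fromℕ< v<n , trans (cong toℕ (inverseʳ π)) (toℕ-fromℕ< v<n)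

  classical-occurrence : ∀ (σ : Perm 3) {a b c : Fin n} → a < b → b < c →
    (h : Fin 3 → ℕ) → (∀ i j → i < j → h i ℕ.< h j) →
    (∀ i → value ((a ∷ b ∷ c ∷ []) i) ≡ h (σ ⟨$⟩ʳ i)) →
    Contains π (classical σ)
  classical-occurrence σ {a} {b} {c} a<b b<c h h-increasing values =
    a ∷ b ∷ c ∷ [] , triple-increasing {_≺_ = _<_} Fin.<-trans a<b b<c , iso , nothing-in-⊥ , nothing-in-⊥
    where
    iso : ∀ i j → (value ((a ∷ b ∷ c ∷ []) i) ℕ.< value ((a ∷ b ∷ c ∷ []) j)) ⇔ (σ ⟨$⟩ʳ i < σ ⟨$⟩ʳ j)
    iso i j rewrite values i | values j = increasing⇒<-reflecting h h-increasing (σ ⟨$⟩ʳ i) (σ ⟨$⟩ʳ j)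
    nothing-in-⊥ : ∀ {A : Fin 2 → Set} x → x ∈ ⊥ → A x
    nothing-in-⊥ _ x∈⊥ = ⊥-elim (∉⊥ x∈⊥)

  123-occurrence : ∀ {a b c} → a < b → b < c → value a ℕ.< value b → value b ℕ.< value c →
    Contains π (classical σ123)
  123-occurrence {a} {b} {c} a<b b<c va<vb vb<vc =
    classical-occurrence σ123 a<b b<c (value a ∷ value b ∷ value c ∷ [])
      (triple-increasing {_≺_ = ℕ._<_} ℕ.<-trans va<vb vb<vc)
      λ { Fin.zero → refl ; (Fin.suc Fin.zero) → refl ; (Fin.suc (Fin.suc Fin.zero)) → refl }

  231-occurrence : ∀ {a b c} → a < b → b < c → value c ℕ.< value a → value a ℕ.< value b →
    Contains π (classical σ231)
  231-occurrence {a} {b} {c} a<b b<c vc<va va<vb =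
    classical-occurrence σ231 a<b b<c (value c ∷ value a ∷ value b ∷ [])
      (triple-increasing {_≺_ = ℕ._<_} ℕ.<-trans vc<va va<vb)
      λ { Fin.zero → refl ; (Fin.suc Fin.zero) → refl ; (Fin.suc (Fin.suc Fin.zero)) → refl }

  adjacent-123-occurrence : ∀ {a b c} → a < b → b < c → value b ℕ.< value c →
    value b ≡ suc (value a) → Contains π (pat σ123 ⊥ Y1)
  adjacent-123-occurrence {a} {b} {c} a<b b<c vb<vc vb≡1+va =
    let i , increasing , iso , adjacentˣ , _ =
          123-occurrence a<b b<c (ℕ.≤-reflexive (sym vb≡1+va)) vb<vc
    in i , increasing , iso , adjacentˣ , adjacentʸ
    where
    adjacentʸ : ∀ y → y ∈ Y1 →
      value ((a ∷ b ∷ c ∷ []) (Fin.suc y)) ≡ suc (value ((a ∷ b ∷ c ∷ []) (inject₁ y)))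
    adjacentʸ y y∈ with x∈⁅y⁆⇒x≡y Fin.zero y∈
    ... | refl = vb≡1+va

  module _ (avoids231 : Avoids π (classical σ231)) (avoidsR : Avoids π (pat σ123 ⊥ Y1)) where

    no-123-with-gap : ∀ k {a b c} → a < b → b < c → value b ℕ.< value c →
      suc (value a) + k ≡ value b → Empty
    no-123-above-successor : ∀ k {a b c d} → a < b → b < c → value b ℕ.< value c →
      value d ≡ suc (value a) → suc (value d) + k ≡ value b → Empty

    no-123-with-gap zero a<b b<c vb<vc gap =
      avoidsR (adjacent-123-occurrence a<b b<c vb<vc (trans (sym gap) (+-identityʳ _)))
    no-123-with-gap (suc k) {a} {b} a<b b<c vb<vc gap =
      let d , vd≡1+va = position-of (suc (value a)) (ℕ.<-trans (gap⇒< gap′) (toℕ<n (π ⟨$⟩ʳ b)))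
      in no-123-above-successor k a<b b<c vb<vc vd≡1+va
           (subst (λ v → suc v + k ≡ value b) (sym vd≡1+va) gap′)
      where
      gap′ : suc (suc (value a)) + k ≡ value b
      gap′ = trans (sym (+-suc (suc (value a)) k)) gap

    no-123-above-successor k {a} {b} {c} {d} a<b b<c vb<vc vd≡1+va gap
      with Fin.<-cmp d b | Fin.<-cmp d c
    ... | tri< d<b _ _ | _ = no-123-with-gap k d<b b<c vb<vc gap
    ... | tri≈ _ refl _ | _ = ℕ.<-irrefl refl (gap⇒< gap)
    ... | tri> _ _ b<d | tri< d<c _ _ =
      avoidsR (adjacent-123-occurrence (Fin.<-trans a<b b<d) d<c (ℕ.<-trans (gap⇒< gap) vb<vc) vd≡1+va)
    ... | tri> _ _ _ | tri≈ _ refl _ = ℕ.<-irrefl refl (ℕ.<-trans (gap⇒< gap) vb<vc)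
    ... | tri> _ _ _ | tri> _ _ c<d = avoids231 (231-occurrence b<c c<d (gap⇒< gap) vb<vc)

    avoids-123 : Avoids π (classical σ123)
    avoids-123 (i , increasing , iso , _ , _) =
      no-123-with-gap (value (i one) ∸ suc (value (i Fin.zero)))
        (increasing Fin.zero one (s≤s z≤n)) (increasing one two (s≤s (s≤s z≤n)))
        (Equivalence.from (iso one two) (s≤s (s≤s z≤n)))
        (m+[n∸m]≡n (Equivalence.from (iso Fin.zero one) (s≤s z≤n)))
      where
      one two : Fin 3
      one = Fin.suc Fin.zero
      two = Fin.suc (Fin.suc Fin.zero)

proposition9 : (n : ℕ) (π : Perm n) →
    InAv2 (classical σ231) (pat σ123 ⊥ Y1) π ⇔ InAv2 (classical σ123) (classical σ231) π
proposition9 n π = mk⇔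
  (λ (avoids231 , avoidsR) → avoids-123 π avoids231 avoidsR , avoids231)
  (λ (avoids123 , avoids231) →
    avoids231 , λ occurrence → avoids123 (Contains-⊆ʸ {π = π} {σ = σ123} ⊥⊆ occurrence))
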